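{- For all integers $n\geq 0$ and $k\geq 2$, the map $$f:\mathcal{C}_n^{(k)}\longrightarrow \bigcup_{i=0}^{n}\mathrm{Com}_{i+1}(n+1)\times\mathcal{E}_i^{(k)},\qquad f(F)=(c,\mathcal{D}(F)),$$ is a bijection.
   Context: The triangular shape $\triangle_n$ is the set of cells $(r,c)$ (row $r$, column $c$) with $1\leq c\leq r\leq n$ (rows numbered top to bottom, columns left to right; row $r$ has $r$ cells). A $01$-filling of $\triangle_n$ assigns $0$ or $1$ to each cell. An SE-chain of length $k$ is a set of cells $(r_1,c_1),\dots,(r_k,c_k)$ filled with $1$ such that $r_1<\cdots<r_k$ and $c_1<\cdots<c_k$; it is proper if the smallest rectangle containing it lies in $\triangle_n$ (i.e. $c_k\leq r_1$). $\mathcal{C}_n^{(k)}$ is the set of $01$-fillings of $\triangle_n$ in which every row and every column contains at most one $1$ and there is no proper SE-chain of length $k$. For $j\in[n]$ the $j$-th corner hook is the union of row $j$ and column $j$; it is zero if it contains no $1$, nonzero otherwise. $\mathcal{E}_n^{(k)}$ is the subset of $\mathcal{C}_n^{(k)}$ of fillings with no zero corner hook ($\mathcal{E}_0^{(k)}$ consists of the empty filling). An $i$-composition of $m$ is a sequence $c_1\cdots c_i$ of positive integers summing to $m$; $\mathrm{Com}_i(m)$ is the set of these. For $F\in\mathcal{C}_n^{(k)}$, let $S=\{s_1<\dots<s_i\}$ be the set of $j\in[n]$ whose $j$-th corner hook is nonzero; then $c=c_1\cdots c_{i+1}\in\mathrm{Com}_{i+1}(n+1)$ is defined by $\{c_1,c_1+c_2,\dots,c_1+\cdots+c_i\}=S$,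 and $\mathcal{D}(F)$ is the $01$-filling of $\triangle_i$ whose cell $(a,b)$ has the entry of cell $(s_a,s_b)$ of $F$ (i.e. all cells of zero corner hooks are removed and the rest compressed). -}

module Defs where

open import Data.Nat using (ℕ; zero; suc; _+_; _∸_; _≤_; _<_)
open import Data.Bool using (Bool; true; false; _∨_; if_then_else_)
open import Data.List using (List; []; _∷_; length; filter; map)
open import Data.Bool.ListAction using (any)
open import Data.Nat.ListAction using (sum)
open import Data.List.Relation.Unary.All using (All)
open import Data.Vec using (Vec; toList; tabulate)
open import Data.Fin using (Fin; toℕ)
open import Data.Product using (Σ; _×_; _,_; ∃)
open import Data.Unit using (⊤; tt)
open import Relation.Binary.PropositionalEquality using (_≡_)
open import Relation.Nullary using (¬_)
open import Data.Nat using (_≡ᵇ_)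

-- A 01-filling of the triangular shape △ₙ: row r (1 ≤ r ≤ n) has r cells.
-- Tri (suc n) = (filling of the first n rows) × (last row, of length n+1).
Tri : ℕ → Set
Tri zero    = ⊤
Tri (suc n) = Tri n × Vec Bool (suc n)

lookupB : List Bool → ℕ → Bool
lookupB []       _             = false
lookupB (x ∷ xs) zero          = false
lookupB (x ∷ xs) (suc zero)    = x
lookupB (x ∷ xs) (suc (suc c)) = lookupB xs (suc c)

-- entry F r c : the entry of cell (r,c) (1-indexed); false outside △ₙ.
entry : {n : ℕ} → Tri n → ℕ → ℕ → Bool
entry {zero}  _         r c = false
entry {suc n} (F , row) r c =
  if r ≡ᵇ suc n then lookupB (toList row) c else entry F r c

RowColOK : {n : ℕ} → Tri n → Set
RowColOK F =
  (∀ r c c' → entry F r c ≡ true → entry F r c' ≡ true → c ≡ c') ×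
  (∀ c r r' → entry F r c ≡ true → entry F r' c ≡ true → r ≡ r')

-- a proper SE-chain of length k: cells (rs i , cs i), i : Fin k, filled with 1,
-- strictly increasing in rows and columns, whose smallest enclosing rectangle
-- lies in △ₙ (every column index of the chain ≤ every row index, i.e. c_k ≤ r_1).
ProperSEChain : {n : ℕ} → Tri n → (k : ℕ) → (Fin k → ℕ) → (Fin k → ℕ) → Set
ProperSEChain F k rs cs =
  (∀ i → entry F (rs i) (cs i) ≡ true) ×
  (∀ i j → toℕ i < toℕ j → rs i < rs j) ×
  (∀ i j → toℕ i < toℕ j → cs i < cs j) ×
  (∀ i j → cs j ≤ rs i)

InC : (k n : ℕ) → Tri n → Set
InC k n F = RowColOK F × ¬ (Σ (Fin k → ℕ) λ rs → Σ (Fin k → ℕ) λ cs → ProperSEChain F k rs cs)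

range1 : ℕ → List ℕ
range1 n = toList (tabulate {n = n} (λ (i : Fin n) → suc (toℕ i)))

-- the j-th corner hook (row j ∪ column j) is nonzero
hookNZ : {n : ℕ} → Tri n → ℕ → Bool
hookNZ {n} F j = any (λ c → entry F j c) (range1 n) ∨ any (λ r → entry F r j) (range1 n)

InE : (k n : ℕ) → Tri n → Set
InE k n F = InC k n F × (∀ j → 1 ≤ j → j ≤ n → hookNZ F j ≡ true)

IsComp : (i m : ℕ) → List ℕ → Set
IsComp i m c = length c ≡ i × All (λ x → 1 ≤ x) c × sum c ≡ m

hookSet : {n : ℕ} → Tri n → List ℕ
hookSet {n} F = filter (λ j → Data.Bool._≟_ (hookNZ F j) true) (range1 n)

-- the composition c₁⋯c_{i+1} of m with partial sums c₁ + ⋯ + c_t = s_t (t ≤ i):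
-- c_t = s_t − s_{t−1} (s₀ = 0), c_{i+1} = m − s_i
compOf : ℕ → ℕ → List ℕ → List ℕ
compOf m prev []       = (m ∸ prev) ∷ []
compOf m prev (s ∷ ss) = (s ∸ prev) ∷ compOf m s ss

lookupN : List ℕ → ℕ → ℕ
lookupN []       _             = 0
lookupN (x ∷ xs) zero          = 0
lookupN (x ∷ xs) (suc zero)    = x
lookupN (x ∷ xs) (suc (suc a)) = lookupN xs (suc a)

tabTri : (ℕ → ℕ → Bool) → (i : ℕ) → Tri i
tabTri g zero    = tt
tabTri g (suc i) = tabTri g i , tabulate (λ (b : Fin (suc i)) → g (suc i) (suc (toℕ b)))

D : {n : ℕ} → (F : Tri n) → Tri (length (hookSet F))
D F = tabTri (λ a b → entry F (lookupN (hookSet F) a) (lookupN (hookSet F) b)) (length (hookSet F))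

-- the codomain ⋃ᵢ Com_{i+1}(n+1) × ℰᵢ^(k), elements tagged by i
Target : Set
Target = Σ ℕ λ i → List ℕ × Tri i

InTarget : (k n : ℕ) → Target → Set
InTarget k n (i , c , G) = i ≤ n × IsComp (suc i) (suc n) c × InE k i G

f : {n : ℕ} → Tri n → Target
f {n} F = length (hookSet F) , compOf (suc n) 0 (hookSet F) , D F

IsBijectionOnto : (k n : ℕ) → Set
IsBijectionOnto k n =
  (∀ F → InC k n F → InTarget k n (f F)) ×
  (∀ F G → InC k n F → InC k n G → f F ≡ f G → F ≡ G) ×
  (∀ y → InTarget k n y → Σ (Tri n) λ F → InC k n F × f F ≡ y)

module Submission where

-- A filling F of △ₙ is determined by the list S = s₁ < ⋯ < sᵢ of its nonzero
-- corner hooks and by 𝒟(F), since every 1 of F lies in a row and a column in S.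

open import Defs
open import Data.Bool as Bool using (Bool; true; false; T)
open import Data.Bool.Properties using (T-≡; T-∨)
open import Data.Bool.ListAction using (any)
open import Data.Nat using (ℕ; zero; suc; _+_; _∸_; _≤_; _<_; _≡ᵇ_; _≟_; z≤n; s≤s)
open import Data.Nat.Properties
open import Data.Nat.ListAction using (sum)
open import Data.Fin as Fin using (Fin; toℕ; fromℕ<)
open import Data.Fin.Properties using (toℕ≤pred[n]; toℕ-fromℕ<)
open import Data.Vec as Vec using (Vec; toList; tabulate)
open import Data.Vec.Properties using (length-toList; tabulate-cong; tabulate∘lookup)
open import Data.List as List using (List; []; _∷_; length; filter)
open import Data.List.Properties using (length-filter; ∷-injectiveˡ; ∷-injectiveʳ)
open import Data.List.Membership.Propositional using (_∈_; lose)
open import Data.List.Membership.Propositional.Properties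
  using (∈-filter⁺; ∈-filter⁻; ∈-tabulate⁺)
open import Data.List.Relation.Unary.All as All using (All; []; _∷_)
open import Data.List.Relation.Unary.Any using (here; there; satisfied)
open import Data.List.Relation.Unary.Any.Properties using (any⁺; any⁻; ¬Any[])
open import Data.List.Relation.Unary.AllPairs using (AllPairs; []; _∷_)
import Data.List.Relation.Unary.AllPairs.Properties as AllPairs
open import Data.List.Relation.Unary.Linked using (Linked; [-]; _∷_)
open import Data.List.Relation.Unary.Linked.Properties using (Linked⇒AllPairs)
open import Data.Product using (Σ; ∃; _×_; _,_; proj₁; proj₂)
open import Data.Sum using (_⊎_; inj₁; inj₂)
open import Data.Empty using (⊥-elim)
open import Data.Unit using (tt)
open import Function using (_∘_)
open import Function.Bundles using (Equivalence)
open import Relation.Binary.PropositionalEquality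
open import Relation.Nullary using (Dec; yes; no)

true-ext : {x y : Bool} → (x ≡ true → y ≡ true) → (y ≡ true → x ≡ true) → x ≡ y
true-ext {false} {false} _   _   = refl
true-ext {false} {true}  _   y⇒x = y⇒x refl
true-ext {true}  {false} x⇒y _   = sym (x⇒y refl)
true-ext {true}  {true}  _   _   = refl

T⇒≡true : {b : Bool} → T b → b ≡ true
T⇒≡true = Equivalence.to T-≡

≡true⇒T : {b : Bool} → b ≡ true → T b
≡true⇒T = Equivalence.from T-≡

InRange : ℕ → ℕ → Set
InRange L a = 1 ≤ a × a ≤ L

Cell : ℕ → ℕ → ℕ → Set
Cell n r c = 1 ≤ c × c ≤ r × r ≤ n

cell-row : ∀ {n r c} → Cell n r c → InRange n r
cell-row (1≤c , c≤r , r≤n) = ≤-trans 1≤c c≤r , r≤n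

cell-col : ∀ {n r c} → Cell n r c → InRange n c
cell-col (1≤c , c≤r , r≤n) = 1≤c , ≤-trans c≤r r≤n

entry-last : ∀ {n} (F : Tri n) (row : Vec Bool (suc n)) c →
             entry (F , row) (suc n) c ≡ lookupB (toList row) c
entry-last {n} F row c rewrite T⇒≡true (≡⇒≡ᵇ n n refl) = refl

entry-other : ∀ {n} (F : Tri n) (row : Vec Bool (suc n)) {r} c → r ≢ suc n →
              entry (F , row) r c ≡ entry F r c
entry-other {n} F row {r} c r≢ with r ≡ᵇ suc n in eq
... | true  = ⊥-elim (r≢ (≡ᵇ⇒≡ r (suc n) (≡true⇒T eq)))
... | false = refl

lookupB-support : ∀ xs c → lookupB xs c ≡ true → InRange (length xs) c
lookupB-support (x ∷ xs) (suc zero)    _ = s≤s z≤n , s≤s z≤n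
lookupB-support (x ∷ xs) (suc (suc c)) e =
  s≤s z≤n , s≤s (proj₂ (lookupB-support xs (suc c) e))

entry-support : ∀ {n} (F : Tri n) r c → entry F r c ≡ true → Cell n r c
entry-support {suc n} (F , row) r c e with r ≟ suc n
... | yes refl =
  let (1≤c , c≤) = lookupB-support (toList row) c (trans (sym (entry-last F row c)) e)
  in 1≤c , subst (c ≤_) (length-toList row) c≤ , ≤-refl
... | no r≢ =
  let (1≤c , c≤r , r≤n) = entry-support F r c (trans (sym (entry-other F row c r≢)) e)
  in 1≤c , c≤r , m≤n⇒m≤1+n r≤n

lookupB-tabulate : ∀ m (h : ℕ → Bool) c → InRange m c →
                   lookupB (toList (tabulate {n = m} (λ b → h (suc (toℕ b))))) c ≡ h c
lookupB-tabulate (suc m) h (suc zero)    _             = refl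
lookupB-tabulate (suc m) h (suc (suc c)) (_ , s≤s c≤m) =
  lookupB-tabulate m (h ∘ suc) (suc c) (s≤s z≤n , c≤m)

entry-tabTri : ∀ (g : ℕ → ℕ → Bool) n {r c} → Cell n r c → entry (tabTri g n) r c ≡ g r c
entry-tabTri g zero    cell = let (1≤r , r≤0) = cell-row cell in ⊥-elim (n≮0 (≤-trans 1≤r r≤0))
entry-tabTri g (suc n) {r} {c} (1≤c , c≤r , r≤) with r ≟ suc n
... | yes refl = trans (entry-last (tabTri g n) lastRow c)
                       (lookupB-tabulate (suc n) (g (suc n)) c (1≤c , c≤r))
  where lastRow : Vec Bool (suc n)
        lastRow = proj₂ (tabTri g (suc n))
... | no r≢    = trans (entry-other (tabTri g n) lastRow c r≢)
                       (entry-tabTri g n (1≤c , c≤r , ≤-pred (≤∧≢⇒< r≤ r≢)))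
  where lastRow : Vec Bool (suc n)
        lastRow = proj₂ (tabTri g (suc n))

tabTri-true : ∀ g n {r c} → entry (tabTri g n) r c ≡ true → g r c ≡ true
tabTri-true g n {r} {c} e = trans (sym (entry-tabTri g n (entry-support (tabTri g n) r c e))) e

entry-tabTri-supported : ∀ (g : ℕ → ℕ → Bool) n → (∀ {r c} → g r c ≡ true → Cell n r c) →
                         ∀ r c → entry (tabTri g n) r c ≡ g r c
entry-tabTri-supported g n supp r c =
  true-ext (tabTri-true g n) (λ e → trans (entry-tabTri g n (supp e)) e)

tabTri-cong : ∀ {g h : ℕ → ℕ → Bool} n → (∀ {r c} → Cell n r c → g r c ≡ h r c) →
              tabTri g n ≡ tabTri h n
tabTri-cong zero    _   = refl
tabTri-cong (suc n) g≡h = cong₂ _,_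
  (tabTri-cong n (λ (1≤c , c≤r , r≤n) → g≡h (1≤c , c≤r , m≤n⇒m≤1+n r≤n)))
  (tabulate-cong (λ b → g≡h (s≤s z≤n , s≤s (toℕ≤pred[n] b) , ≤-refl)))

lookupB-toList : ∀ {m} (v : Vec Bool m) (b : Fin m) →
                 lookupB (toList v) (suc (toℕ b)) ≡ Vec.lookup v b
lookupB-toList (x Vec.∷ v) Fin.zero    = refl
lookupB-toList (x Vec.∷ v) (Fin.suc b) = lookupB-toList v b

tabTri-entry : ∀ {n} (F : Tri n) → tabTri (entry F) n ≡ F
tabTri-entry {zero}  tt        = refl
tabTri-entry {suc n} (F , row) = cong₂ _,_
  (trans (tabTri-cong n (λ (_ , _ , r≤n) →
           entry-other F row _ (λ r≡ → 1+n≰n (subst (_≤ n) r≡ r≤n))))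
         (tabTri-entry F))
  (trans (tabulate-cong (λ b → trans (entry-last F row _) (lookupB-toList row b)))
         (tabulate∘lookup row))

tri-ext : ∀ {n} (F G : Tri n) → (∀ r c → entry F r c ≡ entry G r c) → F ≡ G
tri-ext {n} F G same = begin
  F                   ≡⟨ sym (tabTri-entry F) ⟩
  tabTri (entry F) n  ≡⟨ tabTri-cong n (λ {r} {c} _ → same r c) ⟩
  tabTri (entry G) n  ≡⟨ tabTri-entry G ⟩
  G                   ∎
  where open ≡-Reasoning

Increasing : List ℕ → Set
Increasing = AllPairs _<_

bump : ℕ → ℕ
bump zero    = zero
bump (suc p) = suc (suc p)

position : List ℕ → ℕ → ℕ
position []      x = 0
position (s ∷ S) x with x ≟ s
... | yes _ = 1
... | no  _ = bump (position S x)

lookupN-∈ : ∀ S {a} → InRange (length S) a → lookupN S a ∈ S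
lookupN-∈ S       {zero}        (() , _)
lookupN-∈ []      {suc a}       (_ , ())
lookupN-∈ (s ∷ S) {suc zero}    _             = here refl
lookupN-∈ (s ∷ S) {suc (suc a)} (_ , s≤s a≤L) = there (lookupN-∈ S (s≤s z≤n , a≤L))

lookupN-range : ∀ S {a} → 1 ≤ lookupN S a → InRange (length S) a
lookupN-range (s ∷ S) {suc zero}    _ = s≤s z≤n , s≤s z≤n
lookupN-range (s ∷ S) {suc (suc a)} p = s≤s z≤n , s≤s (proj₂ (lookupN-range S p))

lookupN-strict : ∀ S → Increasing S → ∀ {a b} → 1 ≤ a → a < b → b ≤ length S →
                 lookupN S a < lookupN S b
lookupN-strict (s ∷ S) (s< ∷ _) {suc zero} {suc (suc b)} _ _ (s≤s b≤L) =
  All.lookup s< (lookupN-∈ S (s≤s z≤n , b≤L))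
lookupN-strict (s ∷ S) (_ ∷ inc) {suc (suc a)} {suc (suc b)} _ (s≤s a<b) (s≤s b≤L) =
  lookupN-strict S inc (s≤s z≤n) a<b b≤L
lookupN-strict (s ∷ S) _ {suc zero} {suc zero} _ (s≤s ()) _
lookupN-strict [] [] {b = suc b} _ _ ()

position-le : ∀ S x → position S x ≤ length S
position-le []      x = z≤n
position-le (s ∷ S) x with x ≟ s
... | yes _ = s≤s z≤n
... | no  _ with position S x | position-le S x
...   | zero  | _   = z≤n
...   | suc p | p≤L = s≤s p≤L

position-pos : ∀ S {x} → x ∈ S → 1 ≤ position S x
position-pos (s ∷ S) {x} x∈ with x ≟ s | x∈
... | yes _   | _         = s≤s z≤n
... | no x≢s  | here x≡s  = ⊥-elim (x≢s x≡s)
... | no _    | there x∈S with position S x | position-pos S x∈S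
...   | suc _ | _ = s≤s z≤n

lookupN-position : ∀ S {x} → 1 ≤ position S x → lookupN S (position S x) ≡ x
lookupN-position (s ∷ S) {x} p with x ≟ s
... | yes x≡s = sym x≡s
... | no _ with position S x | lookupN-position S {x}
lookupN-position (s ∷ S) () | no _ | zero  | _
lookupN-position (s ∷ S) _  | no _ | suc q | ih = ih (s≤s z≤n)

position-mem : ∀ S {x} → 1 ≤ position S x → x ∈ S
position-mem S {x} p = subst (_∈ S) (lookupN-position S p) (lookupN-∈ S (p , position-le S x))

position-lookupN : ∀ S → Increasing S → ∀ {a} → InRange (length S) a →
                   position S (lookupN S a) ≡ a
position-lookupN S       _ {zero}  (() , _)
position-lookupN []      _ {suc a} (_ , ())
position-lookupN (s ∷ S) _ {suc zero} _ with s ≟ s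
... | yes _   = refl
... | no s≢s  = ⊥-elim (s≢s refl)
position-lookupN (s ∷ S) (s< ∷ inc) {suc (suc a)} (_ , s≤s a≤L) with lookupN S (suc a) ≟ s
... | yes y≡s = ⊥-elim (<-irrefl (sym y≡s) (All.lookup s< (lookupN-∈ S (s≤s z≤n , a≤L))))
... | no _ rewrite position-lookupN S inc (s≤s z≤n , a≤L) = refl

module StrictlyMonotone (Dom : ℕ → Set) (h : ℕ → ℕ)
  (strict : ∀ {x y} → Dom x → Dom y → x < y → h x < h y) where

  monotone : ∀ {x y} → Dom x → Dom y → x ≤ y → h x ≤ h y
  monotone dx dy x≤y with m≤n⇒m<n∨m≡n x≤y
  ... | inj₁ x<y  = <⇒≤ (strict dx dy x<y)
  ... | inj₂ refl = ≤-refl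

  reflect-≤ : ∀ {x y} → Dom x → Dom y → h x ≤ h y → x ≤ y
  reflect-≤ dx dy hx≤hy = ≮⇒≥ (λ y<x → <⇒≱ (strict dy dx y<x) hx≤hy)

  reflect-< : ∀ {x y} → Dom x → Dom y → h x < h y → x < y
  reflect-< dx dy hx<hy = ≰⇒> (λ y≤x → <⇒≱ hx<hy (monotone dy dx y≤x))

  injective : ∀ {x y} → Dom x → Dom y → h x ≡ h y → x ≡ y
  injective dx dy eq =
    ≤-antisym (reflect-≤ dx dy (≤-reflexive eq)) (reflect-≤ dy dx (≤-reflexive (sym eq)))

module Relabel (S : List ℕ) (incS : Increasing S) where
  L : ℕ
  L = length S

  σ ι : ℕ → ℕ
  σ = lookupN S
  ι = position S

  σ-strict : ∀ {a b} → InRange L a → InRange L b → a < b → σ a < σ b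
  σ-strict (1≤a , _) (_ , b≤L) a<b = lookupN-strict S incS 1≤a a<b b≤L

  open StrictlyMonotone (InRange L) σ σ-strict public
    renaming (monotone to σ-monotone; reflect-≤ to σ-reflect-≤; reflect-< to σ-reflect-<)
    using ()

  ι-range : ∀ {x} → x ∈ S → InRange L (ι x)
  ι-range {x} x∈ = position-pos S x∈ , position-le S x

  σι : ∀ {x} → x ∈ S → σ (ι x) ≡ x
  σι x∈ = lookupN-position S (position-pos S x∈)

  ισ : ∀ {a} → InRange L a → ι (σ a) ≡ a
  ισ = position-lookupN S incS

  ι-strict : ∀ {x y} → x ∈ S → y ∈ S → x < y → ι x < ι y
  ι-strict x∈ y∈ x<y =
    σ-reflect-< (ι-range x∈) (ι-range y∈) (subst₂ _<_ (sym (σι x∈)) (sym (σι y∈)) x<y)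

  pullback-cell : ∀ {n} (F : Tri n) {a b} → entry F (σ a) (σ b) ≡ true → Cell L a b
  pullback-cell F {a} {b} e =
    let (1≤σb , σb≤σa , _) = entry-support F (σ a) (σ b) e
        b∈ = lookupN-range S 1≤σb
        a∈ = lookupN-range S (≤-trans 1≤σb σb≤σa)
    in proj₁ b∈ , σ-reflect-≤ b∈ a∈ σb≤σa , proj₂ a∈

∸-telescope : ∀ {p s m} → p ≤ s → s ≤ m → (s ∸ p) + (m ∸ s) ≡ m ∸ p
∸-telescope {p} {s} {m} p≤s s≤m = begin
  (s ∸ p) + (m ∸ s)  ≡⟨ +-comm (s ∸ p) (m ∸ s) ⟩
  (m ∸ s) + (s ∸ p)  ≡⟨ sym (+-∸-assoc (m ∸ s) p≤s) ⟩
  (m ∸ s) + s ∸ p    ≡⟨ cong (_∸ p) (m∸n+n≡m s≤m) ⟩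
  m ∸ p              ∎
  where open ≡-Reasoning

compOf-isComp : ∀ m prev S → Increasing (prev ∷ S) → All (_< m) (prev ∷ S) →
                IsComp (suc (length S)) (m ∸ prev) (compOf m prev S)
compOf-isComp m prev []      _                   (prev<m ∷ []) =
  refl , m<n⇒0<n∸m prev<m ∷ [] , +-identityʳ (m ∸ prev)
compOf-isComp m prev (s ∷ S) ((prev<s ∷ _) ∷ inc) (_ ∷ bounded@(s<m ∷ _))
  with compOf-isComp m s S inc bounded
... | len , pos , total =
  cong suc len , m<n⇒0<n∸m prev<s ∷ pos ,
  trans (cong ((s ∸ prev) +_) total) (∸-telescope (<⇒≤ prev<s) (<⇒≤ s<m))

compOf-injective : ∀ m prev S T → Increasing (prev ∷ S) → Increasing (prev ∷ T) →
                   compOf m prev S ≡ compOf m prev T → S ≡ T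
compOf-injective m prev []          []          _ _ _  = refl
compOf-injective m prev []          (t ∷ [])    _ _ ()
compOf-injective m prev []          (t ∷ _ ∷ _) _ _ ()
compOf-injective m prev (s ∷ [])    []          _ _ ()
compOf-injective m prev (s ∷ _ ∷ _) []          _ _ ()
compOf-injective m prev (s ∷ S) (t ∷ T) ((prev<s ∷ _) ∷ incS) ((prev<t ∷ _) ∷ incT) eq
  with refl ← ∸-cancelʳ-≡ (<⇒≤ prev<s) (<⇒≤ prev<t) (∷-injectiveˡ eq) =
  cong (s ∷_) (compOf-injective m s S T incS incT (∷-injectiveʳ eq))

partialSums : ℕ → List ℕ → List ℕ
partialSums acc []           = []
partialSums acc (x ∷ [])     = []
partialSums acc (x ∷ y ∷ ys) = (acc + x) ∷ partialSums (acc + x) (y ∷ ys)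

partialSums-length : ∀ acc x xs → length (partialSums acc (x ∷ xs)) ≡ length xs
partialSums-length acc x []       = refl
partialSums-length acc x (y ∷ ys) = cong suc (partialSums-length (acc + x) y ys)

partialSums-linked : ∀ acc c → All (1 ≤_) c → Linked _<_ (acc ∷ partialSums acc c)
partialSums-linked acc []           _            = [-]
partialSums-linked acc (x ∷ [])     _            = [-]
partialSums-linked acc (x ∷ y ∷ ys) (1≤x ∷ rest) =
  m<m+n acc 1≤x ∷ partialSums-linked (acc + x) (y ∷ ys) rest

partialSums-bounded : ∀ acc c → All (1 ≤_) c → All (_< acc + sum c) (partialSums acc c)
partialSums-bounded acc []           _                = []
partialSums-bounded acc (x ∷ [])     _                = []
partialSums-bounded acc (x ∷ y ∷ ys) (_ ∷ pos@(1≤y ∷ _)) =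
  All.map (λ {z} → subst (z <_) (+-assoc acc x (sum (y ∷ ys))))
          (m<m+n (acc + x) (≤-trans 1≤y (m≤m+n y (sum ys))) ∷
           partialSums-bounded (acc + x) (y ∷ ys) pos)

partialSums-compOf : ∀ m acc x xs → acc + sum (x ∷ xs) ≡ m →
                     compOf m acc (partialSums acc (x ∷ xs)) ≡ x ∷ xs
partialSums-compOf m acc x []       total = cong (_∷ []) (begin
  m ∸ acc              ≡⟨ cong (_∸ acc) (sym total) ⟩
  acc + (x + 0) ∸ acc  ≡⟨ m+n∸m≡n acc (x + 0) ⟩
  x + 0                ≡⟨ +-identityʳ x ⟩
  x                    ∎)
  where open ≡-Reasoning
partialSums-compOf m acc x (y ∷ ys) total =
  cong₂ _∷_ (m+n∸m≡n acc x)
            (partialSums-compOf m (acc + x) y ys (trans (+-assoc acc x (sum (y ∷ ys))) total))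

compositionSet : ∀ {i m c} → IsComp (suc i) m c →
                 Σ (List ℕ) λ S →
                   Increasing (0 ∷ S) × All (_< m) S × length S ≡ i × compOf m 0 S ≡ c
compositionSet {c = []}     (() , _)
compositionSet {m = m} {c = x ∷ xs} (len , pos , total) =
  partialSums 0 (x ∷ xs) ,
  Linked⇒AllPairs <-trans (partialSums-linked 0 (x ∷ xs) pos) ,
  subst (λ t → All (_< t) (partialSums 0 (x ∷ xs))) total (partialSums-bounded 0 (x ∷ xs) pos) ,
  trans (partialSums-length 0 x xs) (suc-injective len) ,
  partialSums-compOf m 0 x xs total

HasOne : ∀ {n} → Tri n → ℕ → Set
HasOne F j = (∃ λ c → entry F j c ≡ true) ⊎ (∃ λ r → entry F r j ≡ true)

hasOne-range : ∀ {n} (F : Tri n) {j} → HasOne F j → InRange n j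
hasOne-range F {j} (inj₁ (c , e)) = cell-row (entry-support F j c e)
hasOne-range F {j} (inj₂ (r , e)) = cell-col (entry-support F r j e)

toList-tabulate : ∀ {A : Set} {n} (g : Fin n → A) → toList (tabulate g) ≡ List.tabulate g
toList-tabulate {n = zero}  g = refl
toList-tabulate {n = suc n} g = cong (g Fin.zero ∷_) (toList-tabulate (g ∘ Fin.suc))

range1-tabulate : ∀ n → range1 n ≡ List.tabulate {n = n} (suc ∘ toℕ)
range1-tabulate n = toList-tabulate (suc ∘ toℕ)

∈-range1 : ∀ n {x} → InRange n x → x ∈ range1 n
∈-range1 n       {zero}  (() , _)
∈-range1 zero    {suc x} (_ , ())
∈-range1 (suc n) {suc x} (_ , s≤s x≤n) =
  subst₂ _∈_ (cong suc (toℕ-fromℕ< (s≤s x≤n))) (sym (range1-tabulate (suc n)))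
         (∈-tabulate⁺ {f = suc ∘ toℕ} (fromℕ< (s≤s x≤n)))

range1-increasing : ∀ n → Increasing (range1 n)
range1-increasing n = subst Increasing (sym (range1-tabulate n)) (AllPairs.tabulate⁺-< s≤s)

any-true : ∀ n (p : ℕ → Bool) → any p (range1 n) ≡ true → ∃ λ x → p x ≡ true
any-true n p e = let (x , px) = satisfied (any⁻ p (range1 n) (≡true⇒T e)) in x , T⇒≡true px

true-any : ∀ n (p : ℕ → Bool) {x} → InRange n x → p x ≡ true → any p (range1 n) ≡ true
true-any n p x∈ px = T⇒≡true (any⁺ p (lose (∈-range1 n x∈) (≡true⇒T px)))

hookNZ⇒hasOne : ∀ {n} (F : Tri n) {j} → hookNZ F j ≡ true → HasOne F j
hookNZ⇒hasOne {n} F {j} e with Equivalence.to T-∨ (≡true⇒T e)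
... | inj₁ inRow = inj₁ (any-true n (entry F j) (T⇒≡true inRow))
... | inj₂ inCol = inj₂ (any-true n (λ r → entry F r j) (T⇒≡true inCol))

hasOne⇒hookNZ : ∀ {n} (F : Tri n) {j} → HasOne F j → hookNZ F j ≡ true
hasOne⇒hookNZ {n} F {j} (inj₁ (c , e)) = T⇒≡true (Equivalence.from T-∨ (inj₁ (≡true⇒T
  (true-any n (entry F j) (cell-col (entry-support F j c e)) e))))
hasOne⇒hookNZ {n} F {j} (inj₂ (r , e)) = T⇒≡true (Equivalence.from T-∨ (inj₂ (≡true⇒T
  (true-any n (λ r → entry F r j) (cell-row (entry-support F r j e)) e))))

isHook? : ∀ {n} (F : Tri n) j → Dec (hookNZ F j ≡ true)
isHook? F j = hookNZ F j Bool.≟ true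

hookSet-∈⁻ : ∀ {n} (F : Tri n) {x} → x ∈ hookSet F → HasOne F x
hookSet-∈⁻ {n} F x∈ = hookNZ⇒hasOne F (proj₂ (∈-filter⁻ (isHook? F) {xs = range1 n} x∈))

hookSet-∈⁺ : ∀ {n} (F : Tri n) {x} → HasOne F x → x ∈ hookSet F
hookSet-∈⁺ {n} F h = ∈-filter⁺ (isHook? F) (∈-range1 n (hasOne-range F h)) (hasOne⇒hookNZ F h)

hookSet-range : ∀ {n} (F : Tri n) → All (InRange n) (hookSet F)
hookSet-range F = All.tabulate (hasOne-range F ∘ hookSet-∈⁻ F)

hookSet-sorted : ∀ {n} (F : Tri n) → Increasing (hookSet F)
hookSet-sorted {n} F = AllPairs.filter⁺ (isHook? F) (range1-increasing n)

hookSet-increasing : ∀ {n} (F : Tri n) → Increasing (0 ∷ hookSet F)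
hookSet-increasing F = All.map proj₁ (hookSet-range F) ∷ hookSet-sorted F

hookSet-length : ∀ {n} (F : Tri n) → length (hookSet F) ≤ n
hookSet-length {n} F =
  ≤-trans (length-filter (isHook? F) (range1 n))
          (≤-reflexive (length-toList (tabulate {n = n} (suc ∘ toℕ))))

hookSet-supported : ∀ {n} (F : Tri n) {r c} → entry F r c ≡ true →
                    r ∈ hookSet F × c ∈ hookSet F
hookSet-supported F {r} {c} e = hookSet-∈⁺ F (inj₁ (c , e)) , hookSet-∈⁺ F (inj₂ (r , e))

module Embedding {n m} (F : Tri n) (G : Tri m) (Dom : ℕ → Set) (h : ℕ → ℕ)
  (support  : ∀ {r c} → entry F r c ≡ true → Dom r × Dom c)
  (strict   : ∀ {x y} → Dom x → Dom y → x < y → h x < h y)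
  (preserve : ∀ {r c} → entry F r c ≡ true → entry G (h r) (h c) ≡ true) where

  open StrictlyMonotone Dom h strict

  rowCol-reflect : RowColOK G → RowColOK F
  rowCol-reflect (rowG , colG) =
    (λ r c c' e e' → injective (proj₂ (support e)) (proj₂ (support e'))
                       (rowG (h r) (h c) (h c') (preserve e) (preserve e'))) ,
    (λ c r r' e e' → injective (proj₁ (support e)) (proj₁ (support e'))
                       (colG (h c) (h r) (h r') (preserve e) (preserve e')))

  chain-preserve : ∀ {k rs cs} → ProperSEChain F k rs cs → ProperSEChain G k (h ∘ rs) (h ∘ cs)
  chain-preserve {rs = rs} {cs} (ones , rows< , cols< , proper) =
    (λ t → preserve (ones t)) ,
    (λ t u t<u → strict (row t) (row u) (rows< t u t<u)) ,
    (λ t u t<u → strict (col t) (col u) (cols< t u t<u)) ,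
    (λ t u → monotone (col u) (row t) (proper t u))
    where
    row : ∀ t → Dom (rs t)
    row t = proj₁ (support (ones t))
    col : ∀ t → Dom (cs t)
    col t = proj₂ (support (ones t))

  inC-reflect : ∀ {k} → InC k m G → InC k n F
  inC-reflect (ok , noChain) =
    rowCol-reflect ok , λ (rs , cs , chain) → noChain (h ∘ rs , h ∘ cs , chain-preserve chain)

  hook-preserve : ∀ {j} → HasOne F j → HasOne G (h j)
  hook-preserve (inj₁ (c , e)) = inj₁ (h c , preserve e)
  hook-preserve (inj₂ (r , e)) = inj₂ (h r , preserve e)

-- F is supported on the rows and columns in S, and G is F read at S × S:
-- G is the compression of F along S.  F and G embed into each other.
module Compression {n} (S : List ℕ) (incS : Increasing S) (F : Tri n) (G : Tri (length S))
  (supported : ∀ {r c} → entry F r c ≡ true → r ∈ S × c ∈ S)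
  (pullback  : ∀ a b → entry G a b ≡ entry F (lookupN S a) (lookupN S b)) where

  open Relabel S incS

  private
    ι-preserve : ∀ {r c} → entry F r c ≡ true → entry G (ι r) (ι c) ≡ true
    ι-preserve {r} {c} e = begin
      entry G (ι r) (ι c)          ≡⟨ pullback (ι r) (ι c) ⟩
      entry F (σ (ι r)) (σ (ι c))  ≡⟨ cong₂ (entry F) (σι r∈) (σι c∈) ⟩
      entry F r c                  ≡⟨ e ⟩
      true                         ∎
      where
      open ≡-Reasoning
      r∈ : r ∈ S
      r∈ = proj₁ (supported e)
      c∈ : c ∈ S
      c∈ = proj₂ (supported e)

    σ-support : ∀ {a b} → entry G a b ≡ true → InRange L a × InRange L b
    σ-support {a} {b} e = let cell = entry-support G a b e in cell-row cell , cell-col cell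

    σ-preserve : ∀ {a b} → entry G a b ≡ true → entry F (σ a) (σ b) ≡ true
    σ-preserve {a} {b} e = trans (sym (pullback a b)) e

  module ιEmbedding = Embedding F G (_∈ S) ι supported ι-strict ι-preserve
  module σEmbedding = Embedding G F (InRange L) σ σ-support σ-strict σ-preserve

  inC⇒ : ∀ {k} → InC k n F → InC k L G
  inC⇒ = σEmbedding.inC-reflect

  inC⇐ : ∀ {k} → InC k L G → InC k n F
  inC⇐ = ιEmbedding.inC-reflect

  decompress : ∀ r c → entry F r c ≡ entry G (ι r) (ι c)
  decompress r c = true-ext ι-preserve λ e →
    let (ιr∈ , ιc∈) = σ-support e
    in subst₂ (λ x y → entry F x y ≡ true)
              (lookupN-position S (proj₁ ιr∈)) (lookupN-position S (proj₁ ιc∈)) (σ-preserve e)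

  hasOne-∈ : ∀ {x} → HasOne F x → x ∈ S
  hasOne-∈ (inj₁ (c , e)) = proj₁ (supported e)
  hasOne-∈ (inj₂ (r , e)) = proj₂ (supported e)

  hasOne⇒ : ∀ {a} → InRange L a → HasOne F (σ a) → HasOne G a
  hasOne⇒ a∈ h = subst (HasOne G) (ισ a∈) (ιEmbedding.hook-preserve h)

  hasOne⇐ : ∀ {x} → x ∈ S → HasOne G (ι x) → HasOne F x
  hasOne⇐ x∈ h = subst (HasOne F) (σι x∈) (σEmbedding.hook-preserve h)

D-pullback : ∀ {n} (F : Tri n) a b →
             entry (D F) a b ≡ entry F (lookupN (hookSet F) a) (lookupN (hookSet F) b)
D-pullback F = entry-tabTri-supported _ _ (Relabel.pullback-cell (hookSet F) (hookSet-sorted F) F)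

module OwnCompression {n} (F : Tri n) =
  Compression (hookSet F) (hookSet-sorted F) F (D F) (hookSet-supported F) (D-pullback F)

f-characterisation : ∀ {n} (F : Tri n) {S} → hookSet F ≡ S → (G : Tri (length S)) →
                     (∀ a b → entry G a b ≡ entry F (lookupN S a) (lookupN S b)) →
                     f F ≡ (length S , compOf (suc n) 0 S , G)
f-characterisation F refl G pullback =
  cong (λ H → (_ , _ , H)) (tri-ext (D F) G (λ a b → trans (D-pullback F a b) (sym (pullback a b))))

expand : ∀ n (S : List ℕ) {m} → Tri m → Tri n
expand n S G = tabTri (λ r c → entry G (position S r) (position S c)) n

expand-supported : ∀ n S {m} (G : Tri m) {r c} → entry (expand n S G) r c ≡ true →
                   r ∈ S × c ∈ S
expand-supported n S G {r} {c} e =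
  let cell = entry-support G _ _ (tabTri-true _ n e)
  in position-mem S (proj₁ (cell-row cell)) , position-mem S (proj₁ (cell-col cell))

expand-pullback : ∀ n S → Increasing S → All (InRange n) S → (G : Tri (length S)) →
                  ∀ a b → entry G a b ≡ entry (expand n S G) (lookupN S a) (lookupN S b)
expand-pullback n S incS S⊆ G a b = true-ext to from
  where
  open Relabel S incS
  to : entry G a b ≡ true → entry (expand n S G) (σ a) (σ b) ≡ true
  to e = let (1≤b , b≤a , a≤L) = entry-support G a b e
             a∈ = (≤-trans 1≤b b≤a , a≤L)
             b∈ = (1≤b , ≤-trans b≤a a≤L)
             σcell = proj₁ (All.lookup S⊆ (lookupN-∈ S b∈)) , σ-monotone b∈ a∈ b≤a ,
                     proj₂ (All.lookup S⊆ (lookupN-∈ S a∈))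
         in trans (entry-tabTri _ n σcell)
                  (subst₂ (λ x y → entry G x y ≡ true) (sym (ισ a∈)) (sym (ισ b∈)) e)
  from : entry (expand n S G) (σ a) (σ b) ≡ true → entry G a b ≡ true
  from e = let (1≤σb , σb≤σa , _) = entry-support (expand n S G) (σ a) (σ b) e
           in subst₂ (λ x y → entry G x y ≡ true)
                     (ισ (lookupN-range S (≤-trans 1≤σb σb≤σa))) (ισ (lookupN-range S 1≤σb))
                     (tabTri-true _ n e)

head-≤ : ∀ {x y ys} → Increasing (y ∷ ys) → x ∈ y ∷ ys → y ≤ x
head-≤ _        (here refl) = ≤-refl
head-≤ (y< ∷ _) (there x∈)  = <⇒≤ (All.lookup y< x∈)

drop-head : ∀ {x xs y ys z} → Increasing (x ∷ xs) → x ≡ y → z ∈ xs → z ∈ y ∷ ys → z ∈ ys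
drop-head (x< ∷ _) refl z∈ (here refl) = ⊥-elim (<-irrefl refl (All.lookup x< z∈))
drop-head _        _    _  (there z∈)  = z∈

increasing-ext : ∀ xs ys → Increasing xs → Increasing ys →
                 (∀ {z} → z ∈ xs → z ∈ ys) → (∀ {z} → z ∈ ys → z ∈ xs) → xs ≡ ys
increasing-ext []       []       _ _ _ _ = refl
increasing-ext []       (y ∷ ys) _ _ _ ⊇ = ⊥-elim (¬Any[] (⊇ (here refl)))
increasing-ext (x ∷ xs) []       _ _ ⊆ _ = ⊥-elim (¬Any[] (⊆ (here refl)))
increasing-ext (x ∷ xs) (y ∷ ys) incx@(_ ∷ incxs) incy@(_ ∷ incys) ⊆ ⊇ =
  cong₂ _∷_ x≡y (increasing-ext xs ys incxs incys
    (λ z∈ → drop-head incx x≡y z∈ (⊆ (there z∈)))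
    (λ z∈ → drop-head incy (sym x≡y) z∈ (⊇ (there z∈))))
  where
  x≡y : x ≡ y
  x≡y = ≤-antisym (head-≤ incx (⊇ (here refl))) (head-≤ incy (⊆ (here refl)))

-- f maps 𝒞ₙ^(k) into the target: 𝒟(F) is the compression of F along its hook set.
maps-into : ∀ n k (F : Tri n) → InC k n F → InTarget k n (f F)
maps-into n k F inC = hookSet-length F , composition , inC⇒ inC , hooksNonzero
  where
  S : List ℕ
  S = hookSet F
  open OwnCompression F
  composition : IsComp (suc (length S)) (suc n) (compOf (suc n) 0 S)
  composition =
    compOf-isComp (suc n) 0 S (hookSet-increasing F) (s≤s z≤n ∷ All.map (s≤s ∘ proj₂) (hookSet-range F))
  hooksNonzero : ∀ a → 1 ≤ a → a ≤ length S → hookNZ (D F) a ≡ true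
  hooksNonzero a 1≤a a≤L =
    hasOne⇒hookNZ (D F) (hasOne⇒ (1≤a , a≤L) (hookSet-∈⁻ F (lookupN-∈ S (1≤a , a≤L))))

-- f is injective: F is the decompression of 𝒟(F) along hookSet F, which the
-- composition determines.
injective : ∀ n k (F₁ F₂ : Tri n) → InC k n F₁ → InC k n F₂ → f F₁ ≡ f F₂ → F₁ ≡ F₂
injective n k F₁ F₂ _ _ same = tri-ext F₁ F₂ λ r c → begin
  entry F₁ r c                ≡⟨ C₁.decompress r c ⟩
  entry (D F₁) (ι₁ r) (ι₁ c)  ≡⟨ cong (λ y → entry (proj₂ (proj₂ y)) (ι₁ r) (ι₁ c)) same ⟩
  entry (D F₂) (ι₁ r) (ι₁ c)  ≡⟨ cong (λ T → entry (D F₂) (position T r) (position T c)) sameHooks ⟩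
  entry (D F₂) (ι₂ r) (ι₂ c)  ≡⟨ sym (C₂.decompress r c) ⟩
  entry F₂ r c                ∎
  where
  open ≡-Reasoning
  module C₁ = OwnCompression F₁
  module C₂ = OwnCompression F₂
  ι₁ ι₂ : ℕ → ℕ
  ι₁ = position (hookSet F₁)
  ι₂ = position (hookSet F₂)
  sameHooks : hookSet F₁ ≡ hookSet F₂
  sameHooks = compOf-injective (suc n) 0 (hookSet F₁) (hookSet F₂)
                (hookSet-increasing F₁) (hookSet-increasing F₂) (cong (proj₁ ∘ proj₂) same)

-- f is onto: decompress G along the partial sums of the composition.
surjective : ∀ n k y → InTarget k n y → Σ (Tri n) λ F → InC k n F × f F ≡ y
surjective n k (i , c , G) (_ , isComp , inC , hooks) with compositionSet isComp
... | S , (positive ∷ incS) , bounded , refl , refl =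
  F , inC⇐ inC , f-characterisation F sameHooks G pullback
  where
  S⊆ : All (InRange n) S
  S⊆ = All.zipWith (λ (0<x , x<1+n) → 0<x , ≤-pred x<1+n) (positive , bounded)
  F : Tri n
  F = expand n S G
  pullback : ∀ a b → entry G a b ≡ entry F (lookupN S a) (lookupN S b)
  pullback = expand-pullback n S incS S⊆ G
  open Compression S incS F G (expand-supported n S G) pullback
  sameHooks : hookSet F ≡ S
  sameHooks = increasing-ext (hookSet F) S (hookSet-sorted F) incS
    (hasOne-∈ ∘ hookSet-∈⁻ F)
    (λ x∈ → let (1≤ιx , ιx≤L) = Relabel.ι-range S incS x∈
            in hookSet-∈⁺ F (hasOne⇐ x∈ (hookNZ⇒hasOne G (hooks _ 1≤ιx ιx≤L))))

-- f is a bijection from 𝒞ₙ^(k) onto ⋃ᵢ Com_{i+1}(n+1) × ℰᵢ^(k); the argument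
-- works for every k.
theorem2p2 : (n k : ℕ) → 2 ≤ k → IsBijectionOnto k n
theorem2p2 n k _ = maps-into n k , injective n k , surjective n k
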